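{- Let $n\ge 2$ and $G_n=C_{2^n}\times C_{2^n}$ with orbit tree $T_n$. If $\chi\in G_n^*$ is a character not of highest order (i.e. of order less than $2^n$), then $\chi$ is the square $\psi^2$ of a character $\psi\in G_n^*$ of higher order. Moreover, if $\chi=\psi^2$ for characters $\chi,\psi\in G_n^*$, then for every node $M$ of $T_n$: $\chi(M)=|M|$ if and only if $\psi(M)=\pm|M|$; $\chi(M)=-|M|$ if and only if $M$ is a child of a node $X$ of $T_n$ with $\psi(X)=-|X|$; and $\chi(M)=0$ for all other nodes $M$. Here $\chi(M)=\sum_{g\in M}\chi(g)$.
   Context: $C_m=\{x/m: x\in\{0,\dots,m-1\}\}$ under addition mod $1$, and $G_n=C_{2^n}\times C_{2^n}$, with dual group $G_n^*$ of complex characters; $\psi^2$ denotes the pointwise square $g\mapsto\psi(g)^2$. The multiplier group $U(2^n)=\{u: u \text{ odd}, 1\le u\le 2^n\}$ acts on $G_n$ by $g\mapsto u\cdot g$. The orbit tree $T_n$ is the rooted tree whose nodes are the orbits of $G_n$ under this action: the root is $\{(0,0)\}$, the nodes at level $i$ are the orbits consisting of elements of order $2^i$ ($0\le i\le n$), and the parent of a node $M$ at level $i+1$ is the orbit containing $2x$ for any $x\in M$; the children of a node are the nodes whose parent it is. -}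

module Defs where

open import Data.Nat using (ℕ; zero; suc; _+_; _*_; _∸_; _^_; _≤_; _<_; _≡ᵇ_; _<ᵇ_; NonZero)
open import Data.Nat.Properties using (m^n≢0)
open import Data.Nat.DivMod using (_mod_; _%_)
import Data.Fin
open import Data.Fin using (Fin)
open import Data.Integer as ℤ using (ℤ; +_; -_)
open import Data.Vec using (Vec; tabulate; replicate; zipWith)
open import Data.List using (List; upTo; allFin; cartesianProduct; filterᵇ; length; foldr; map)
open import Data.Bool using (Bool; true; false; _∧_; if_then_else_)
open import Data.Bool.ListAction using (any)
open import Data.Product using (_×_; _,_; proj₁; proj₂; Σ; ∃)
open import Relation.Binary.PropositionalEquality using (_≡_; _≢_)
open import Relation.Nullary using (¬_)

-- C_{2^n}: the element x/2^n is represented by ⟨ x ⟩ with x : Fin (2^n)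
-- (wrapped in a record so that n can be inferred)
record C (n : ℕ) : Set where
  constructor ⟨_⟩
  field
    val : Fin (2 ^ n)
open C public

toℕ : {n : ℕ} → C n → ℕ
toℕ a = Data.Fin.toℕ (val a)

red : (n : ℕ) → ℕ → C n
red n k = ⟨ _mod_ k (2 ^ n) {{m^n≢0 2 n}} ⟩

G : ℕ → Set
G n = C n × C n

0G : (n : ℕ) → G n
0G n = red n 0 , red n 0

_⊕_ : {n : ℕ} → G n → G n → G n
_⊕_ {n} (a , b) (c , d) = red n (toℕ a + toℕ c) , red n (toℕ b + toℕ d)

_·_ : {n : ℕ} → ℕ → G n → G n
_·_ {n} u (a , b) = red n (u * toℕ a) , red n (u * toℕ b)

allG : (n : ℕ) → List (G n)
allG n = cartesianProduct (map ⟨_⟩ (allFin (2 ^ n))) (map ⟨_⟩ (allFin (2 ^ n)))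

eqGᵇ : {n : ℕ} → G n → G n → Bool
eqGᵇ (a , b) (c , d) = (toℕ a ≡ᵇ toℕ c) ∧ (toℕ b ≡ᵇ toℕ d)

oddᵇ : ℕ → Bool
oddᵇ u = (u % 2) ≡ᵇ 1

inOrbitᵇ : {n : ℕ} → G n → G n → Bool
inOrbitᵇ {n} x g = any (λ u → oddᵇ u ∧ eqGᵇ (u · x) g) (upTo (suc (2 ^ n)))

-- the node (orbit) of T_n represented by x, as a duplicate-free list of its elements
Orbit : {n : ℕ} → G n → List (G n)
Orbit {n} x = filterᵇ (inOrbitᵇ x) (allG n)

card : {n : ℕ} → G n → ℕ
card x = length (Orbit x)

-- M (represented by x) is a child of X (represented by y) in T_n:
-- M is not the root and the orbit of 2x is X.
ChildOf : {n : ℕ} → G n → G n → Set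
ChildOf {n} x y = (x ≢ 0G n) × (inOrbitᵇ y (2 · x) ≡ true)

-- Characters.  The values of a character of G_n are 2^n-th roots of unity;
-- we record χ(g) = exp(2πi k/2^n) by the exponent k : C n.
-- χ is a character iff it is a homomorphism G_n → C_{2^n}.

IsChar : {n : ℕ} → (G n → C n) → Set
IsChar {n} χ = ∀ g h → χ (g ⊕ h) ≡ red n (toℕ (χ g) + toℕ (χ h))

pow : {n : ℕ} → ℕ → (G n → C n) → G n → C n
pow {n} k χ g = red n (k * toℕ (χ g))

sq : {n : ℕ} → (G n → C n) → G n → C n
sq = pow 2

IsTrivial : {n : ℕ} → (G n → C n) → Set
IsTrivial {n} χ = ∀ g → toℕ (χ g) ≡ 0

HasOrder : {n : ℕ} → (G n → C n) → ℕ → Set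
HasOrder χ k = (1 ≤ k) × IsTrivial (pow k χ) × (∀ j → 1 ≤ j → j < k → ¬ IsTrivial (pow j χ))

-- The ring ℤ[ζ], ζ = exp(2πi/2^n), n ≥ 1, represented faithfully as
-- ℤ[x]/(x^(2^(n-1)) + 1) with its power basis 1, ζ, …, ζ^(2^(n-1) - 1).

half : ℕ → ℕ
half n = 2 ^ (n ∸ 1)

Cyc : ℕ → Set
Cyc n = Vec ℤ (half n)

0c : (n : ℕ) → Cyc n
0c n = replicate (half n) (+ 0)

_+c_ : {n : ℕ} → Cyc n → Cyc n → Cyc n
_+c_ = zipWith ℤ._+_

basis : (n : ℕ) → ℤ → ℕ → Cyc n
basis n c j = tabulate (λ i → if Data.Fin.toℕ i ≡ᵇ j then c else + 0)

-- ζ^k for 0 ≤ k < 2^n  (ζ^(h + r) = - ζ^r with h = 2^(n-1))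
zeta : (n : ℕ) → ℕ → Cyc n
zeta n k = if k <ᵇ half n then basis n (+ 1) k else basis n (- + 1) (k ∸ half n)

int : (n : ℕ) → ℤ → Cyc n
int n m = basis n m 0

charSum : {n : ℕ} → (G n → C n) → G n → Cyc n
charSum {n} χ x = foldr (λ g acc → _+c_ {n} (zeta n (toℕ (χ g))) acc) (0c n) (Orbit x)

-- A character of G_n is determined by its values α, β on the two generators: χ(c, d) = (cα + dβ)/2^n.
-- On an orbit M ∋ x it takes the values u·χ(x), u odd, so χ(M) = |M| if χ(x) = 0 and χ(M) = −|M| if
-- χ(x) = 1/2. Otherwise χ(x) = 2^s b/2^n with b odd and s < n − 1, and the odd multiplier
-- w = 1 + 2^(n−1−s) permutes M while adding 1/2 to every value of χ, i.e. negating every root of unity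
-- in the sum; hence χ(M) = −χ(M) = 0.
--
-- If χ = ψ², then χ(x) = 2ψ(x) = ψ(2x): χ(x) = 0 iff ψ(x) ∈ {0, 1/2}, and χ(x) = 1/2 iff ψ takes the
-- value 1/2 on the orbit of 2x, the parent of M.
--
-- Square roots: if χ has order k < 2^n then α and β are even (an odd one would be a unit mod 2^n), so
-- ψ = (α/2, β/2) is a square root of χ. If ψ^k = 1, then (α/2 + 2^(n−1), β/2) is a square root whose k-th
-- power is not trivial: for odd k it moves e₁ to 1/2, and for k = 2t already χ^t = ψ^k = 1. Since ψ^j = 1
-- implies χ^j = 1, the order of this root exceeds k.
module Submission where

open import Defs
open import Data.Nat using (ℕ; _≤_; _<_; _^_)
open import Data.Integer using (+_; -_)
open import Data.Fin using ()
open import Data.Product using (_×_; Σ; ∃; _,_)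
open import Data.Sum using (_⊎_)
open import Function.Bundles using (_⇔_)
open import Relation.Binary.PropositionalEquality using (_≡_)
open import Relation.Nullary using (¬_)

open import Data.Bool using (Bool; true; false; T; T?; _∧_; if_then_else_)
open import Data.Bool.Properties using (T-≡; T-∧)
import Data.Fin.Properties as Fin
open import Data.Integer as ℤ using (ℤ)
import Data.Integer.Properties as ℤ
open import Data.List using (List; []; _∷_; map; foldr; length; allFin; upTo)
open import Data.List.Properties using (map-∘; map-cong-local)
open import Data.List.Membership.Propositional using (_∈_; find; lose)
open import Data.List.Membership.Propositional.Properties
  using (∈-length; ∈-filter⁺; ∈-filter⁻; ∈-upTo⁺; ∈-map⁺; ∈-map⁻; ∈-cartesianProduct⁺; ∈-allFin)
open import Data.List.Membership.Propositional.Properties.WithK using (unique∧set⇒bag)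
open import Data.List.Relation.Binary.BagAndSetEquality using (∼bag⇒↭)
open import Data.List.Relation.Binary.Permutation.Propositional using (_↭_; ↭⇒↭ₛ)
import Data.List.Relation.Binary.Permutation.Propositional.Properties as ↭
open import Data.List.Relation.Binary.Permutation.Setoid.Properties ℤ.≡-setoid using (foldr-commMonoid)
import Data.List.Relation.Unary.All as All
open import Data.List.Relation.Unary.Any.Properties using (any⁺; any⁻)
open import Data.List.Relation.Unary.Unique.Propositional using (Unique)
import Data.List.Relation.Unary.Unique.Propositional.Properties as Unique
open import Data.Nat using (zero; suc; _+_; _*_; _∸_; z≤n; s≤s; NonZero; _≤?_; _≟_; _≡ᵇ_; _<ᵇ_)
open import Data.Nat.Properties
open import Algebra.Properties.CommutativeSemigroup *-commutativeSemigroup using (x∙yz≈y∙xz)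
open import Data.Nat.DivMod
open import Data.Nat.Divisibility using (_∣_; divides; m%n≡0⇒n∣m; *-cancelˡ-∣)
open import Data.Nat.Induction using (<-rec)
open import Data.Nat.Tactic.RingSolver using (solve-∀)
open import Data.Product using (proj₁; proj₂)
open import Data.Sum using (inj₁; inj₂; [_,_]′)
open import Data.Sum.Function.Propositional using (_⊎-⇔_)
open import Data.Empty using (⊥-elim)
open import Data.Vec as Vec using (Vec; lookup; zipWith; replicate)
import Data.Vec.Properties as Vec
open import Data.Vec.Relation.Binary.Pointwise.Extensional using (ext; Pointwise-≡⇒≡)
open import Function using (_∘_; const; case_of_)
open import Function.Bundles using (mk⇔; Equivalence)
open import Function.Properties.Equivalence using () renaming (sym to ⇔-sym; trans to ⇔-trans)
open import Relation.Binary.Definitions using (tri<; tri≈; tri>)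
open import Relation.Binary.PropositionalEquality using (_≢_; refl; sym; trans; cong; cong₂; subst; module ≡-Reasoning)
open import Relation.Nullary using (yes; no)
open import Relation.Nullary.Decidable using (_×-dec_)
open import Relation.Unary using (Decidable)

-- HasOrder χ is, by definition, IsLeastPositive (λ j → IsTrivial (pow j χ)).
IsLeastPositive : (ℕ → Set) → ℕ → Set
IsLeastPositive P k = 1 ≤ k × P k × (∀ j → 1 ≤ j → j < k → ¬ P j)

least-positive : {P : ℕ → Set} → Decidable P → ∀ K → 1 ≤ K → P K → ∃ (IsLeastPositive P)
least-positive P? = <-rec _ λ K rec 1≤K PK →
  case anyUpTo? (λ j → (1 ≤? j) ×-dec P? j) K of λ where
    (yes (j , j<K , 1≤j , Pj)) → rec j<K 1≤j Pj
    (no none) → K , 1≤K , PK , λ j 1≤j j<K Pj → none (j , j<K , 1≤j , Pj)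

IsLeastPositive-resp-⇔ : {P Q : ℕ → Set} → (∀ j → P j ⇔ Q j) →
  ∀ {k} → IsLeastPositive P k → IsLeastPositive Q k
IsLeastPositive-resp-⇔ P⇔Q (1≤k , Pk , least) =
  1≤k , Equivalence.to (P⇔Q _) Pk , λ j 1≤j j<k Qj → least j 1≤j j<k (Equivalence.from (P⇔Q j) Qj)

IsLeastPositive-< : {P Q : ℕ → Set} → (∀ j → Q j → P j) → ∀ {k j} →
  IsLeastPositive P k → IsLeastPositive Q j → ¬ Q k → k < j
IsLeastPositive-< Q⇒P {k} {j} (_ , _ , leastP) (1≤j , Qj , _) ¬Qk with <-cmp k j
... | tri< k<j _ _ = k<j
... | tri≈ _ refl _ = ⊥-elim (¬Qk Qj)
... | tri> _ _ j<k = ⊥-elim (leastP j 1≤j j<k (Q⇒P j Qj))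

m<2m : ∀ {t} → 1 ≤ t → t < 2 * t
m<2m {t} 1≤t = m<m+n t (subst (1 ≤_) (sym (+-identityʳ t)) 1≤t)

1≤2m⇒1≤m : ∀ t → 1 ≤ 2 * t → 1 ≤ t
1≤2m⇒1≤m (suc t) _ = s≤s z≤n

m∣n∧n<2m⇒n≡0⊎n≡m : ∀ {h a} → h ∣ a → a < 2 * h → a ≡ 0 ⊎ a ≡ h
m∣n∧n<2m⇒n≡0⊎n≡m {h} (divides q refl) qh<2h with *-cancelʳ-< h q 2 qh<2h
... | s≤s z≤n       = inj₁ refl
... | s≤s (s≤s z≤n) = inj₂ (+-identityʳ h)

<2m⇒<m⊎≡m+ : ∀ {h a} → a < 2 * h → a < h ⊎ ∃ λ d → d < h × a ≡ h + d
<2m⇒<m⊎≡m+ {h} {a} a<2h with a <? h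
... | yes a<h = inj₁ a<h
... | no  a≮h = inj₂ (a ∸ h , +-cancelˡ-< h (a ∸ h) h (subst (_< h + h) (sym h+[a∸h]≡a) a<h+h) , sym h+[a∸h]≡a)
  where
    h+[a∸h]≡a : h + (a ∸ h) ≡ a
    h+[a∸h]≡a = m+[n∸m]≡n (≮⇒≥ a≮h)
    a<h+h : a < h + h
    a<h+h = subst (a <_) (cong (_+_ h) (+-identityʳ h)) a<2h

module Modular (N : ℕ) .{{_ : NonZero N}} where

  infix 4 _≈_
  _≈_ : ℕ → ℕ → Set
  a ≈ b = a % N ≡ b % N

  %-≈ : ∀ a → a % N ≈ a
  %-≈ a = m%n%n≡m%n a N

  +-cong : ∀ {a b c d} → a ≈ b → c ≈ d → a + c ≈ b + d
  +-cong {a} {b} {c} {d} a≈b c≈d = begin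
    (a + c) % N             ≡⟨ %-distribˡ-+ a c N ⟩
    (a % N + c % N) % N     ≡⟨ cong₂ (λ x y → (x + y) % N) a≈b c≈d ⟩
    (b % N + d % N) % N     ≡⟨ %-distribˡ-+ b d N ⟨
    (b + d) % N             ∎
    where open ≡-Reasoning

  *-cong : ∀ {a b c d} → a ≈ b → c ≈ d → a * c ≈ b * d
  *-cong {a} {b} {c} {d} a≈b c≈d = begin
    (a * c) % N             ≡⟨ %-distribˡ-* a c N ⟩
    (a % N * (c % N)) % N   ≡⟨ cong₂ (λ x y → (x * y) % N) a≈b c≈d ⟩
    (b % N * (d % N)) % N   ≡⟨ %-distribˡ-* b d N ⟨
    (b * d) % N             ∎
    where open ≡-Reasoning

  *-congˡ : ∀ a {c d} → c ≈ d → a * c ≈ a * d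
  *-congˡ a = *-cong {a} refl

  m<n∧[m+m]%n≡m⇒m≡0 : ∀ {z} → z < N → (z + z) % N ≡ z → z ≡ 0
  m<n∧[m+m]%n≡m⇒m≡0 {z} z<N [z+z]%N≡z = begin
    z                        ≡⟨ m<n⇒m%n≡m z<N ⟨
    z % N                    ≡⟨ cong (_% N) z≡qN ⟩
    (z + z) / N * N % N      ≡⟨ m*n%n≡0 ((z + z) / N) N ⟩
    0                        ∎
    where
      open ≡-Reasoning
      z≡qN : z ≡ (z + z) / N * N
      z≡qN = +-cancelˡ-≡ z z _ (trans (m≡m%n+[m/n]*n (z + z) N) (cong (_+ (z + z) / N * N) [z+z]%N≡z))

-- A record, so that u can be inferred from a proof of Odd u.
record Odd (u : ℕ) : Set where
  constructor odd
  field
    %2≡1 : u % 2 ≡ 1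

odd-* : ∀ {a b} → Odd a → Odd b → Odd (a * b)
odd-* {a} {b} (odd a%2≡1) (odd b%2≡1) = odd (trans (%-distribˡ-* a b 2) (cong₂ (λ x y → (x * y) % 2) a%2≡1 b%2≡1))

odd-1+2* : ∀ t → Odd (1 + 2 * t)
odd-1+2* t = odd (trans (cong (λ x → (1 + x) % 2) (*-comm 2 t)) ([m+kn]%n≡m%n 1 t 2))

odd⇒≡1+2* : ∀ {u} → Odd u → u ≡ 1 + 2 * (u / 2)
odd⇒≡1+2* {u} (odd u%2≡1) = trans (m≡m%n+[m/n]*n u 2) (cong₂ _+_ u%2≡1 (*-comm (u / 2) 2))

odd-^ : ∀ {w} → Odd w → ∀ j → Odd (w ^ j)
odd-^ odd-w zero    = odd refl
odd-^ odd-w (suc j) = odd-* odd-w (odd-^ odd-w j)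

even-or-odd : ∀ a → (∃ λ t → a ≡ 2 * t) ⊎ Odd a
even-or-odd a with a % 2 in a%2≡ | m%n<n a 2
... | 0           | _               = inj₁ (a / 2 , trans (m≡m%n+[m/n]*n a 2) (cong₂ _+_ a%2≡ (*-comm (a / 2) 2)))
... | 1           | _               = inj₂ (odd a%2≡)
... | suc (suc _) | s≤s (s≤s ())

2-adic-decomposition : ∀ a → a ≢ 0 → ∃ λ s → ∃ λ b → Odd b × a ≡ 2 ^ s * b
2-adic-decomposition = <-rec (λ a → a ≢ 0 → ∃ λ s → ∃ λ b → Odd b × a ≡ 2 ^ s * b) λ a rec a≢0 →
  case even-or-odd a of λ where
    (inj₂ odd-a)      → 0 , a , odd-a , sym (+-identityʳ a)
    (inj₁ (t , a≡2t)) →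
      let t≢0 = λ t≡0 → a≢0 (trans a≡2t (cong (2 *_) t≡0))
          (s , b , odd-b , t≡) = rec (subst (t <_) (sym a≡2t) (m<2m (n≢0⇒n>0 t≢0))) t≢0
      in suc s , b , odd-b , trans a≡2t (trans (cong (2 *_) t≡) (sym (*-assoc 2 (2 ^ s) b)))

odd^2^k≡1+2^[k+1]* : ∀ {w} → Odd w → ∀ k → ∃ λ c → w ^ (2 ^ k) ≡ 1 + 2 ^ suc k * c
odd^2^k≡1+2^[k+1]* {w} odd-w zero =
  w / 2 , trans (*-identityʳ w) (trans (odd⇒≡1+2* odd-w) (cong (λ x → 1 + x * (w / 2)) (sym (*-identityʳ 2))))
odd^2^k≡1+2^[k+1]* {w} odd-w (suc k) with odd^2^k≡1+2^[k+1]* odd-w k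
... | c , w^2^k≡ = c + 2 ^ k * c * c , (begin
    w ^ (2 * 2 ^ k)                    ≡⟨ cong (w ^_) (*-comm 2 (2 ^ k)) ⟩
    w ^ (2 ^ k * 2)                    ≡⟨ ^-*-assoc w (2 ^ k) 2 ⟨
    (w ^ (2 ^ k)) ^ 2                  ≡⟨ cong (_^ 2) w^2^k≡ ⟩
    (1 + 2 * 2 ^ k * c) ^ 2            ≡⟨ square (2 ^ k) c ⟩
    1 + 2 * (2 * 2 ^ k) * (c + 2 ^ k * c * c) ∎)
  where
    open ≡-Reasoning
    square : ∀ P c → (1 + 2 * P * c) * ((1 + 2 * P * c) * 1) ≡ 1 + 2 * (2 * P) * (c + P * c * c)
    square = solve-∀

sumℤ : List ℤ → ℤ
sumℤ = foldr ℤ._+_ (+ 0)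

sumℤ-↭ : ∀ {xs ys} → xs ↭ ys → sumℤ xs ≡ sumℤ ys
sumℤ-↭ xs↭ys = foldr-commMonoid ℤ.+-0-isCommutativeMonoid (↭⇒↭ₛ xs↭ys)

sumℤ-map-const : ∀ {A : Set} c (xs : List A) → sumℤ (map (const c) xs) ≡ + length xs ℤ.* c
sumℤ-map-const c []       = refl
sumℤ-map-const c (_ ∷ xs) = trans (cong (ℤ._+_ c) (sumℤ-map-const c xs)) (sym (ℤ.suc-* (+ length xs) c))

sumℤ-map-neg : ∀ xs → sumℤ (map -_ xs) ≡ - sumℤ xs
sumℤ-map-neg []       = refl
sumℤ-map-neg (x ∷ xs) = trans (cong (ℤ._+_ (- x)) (sumℤ-map-neg xs)) (sym (ℤ.neg-distrib-+ x (sumℤ xs)))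

i≡-i⇒i≡0 : ∀ {i} → i ≡ - i → i ≡ + 0
i≡-i⇒i≡0 {+ zero}    _ = refl
i≡-i⇒i≡0 {ℤ.+[1+ _ ]} ()
i≡-i⇒i≡0 {ℤ.-[1+ _ ]} ()

+k≢0 : ∀ {k} → 0 < k → + k ≢ + 0
+k≢0 (s≤s _) ()

-k≢0 : ∀ {k} → 0 < k → - + k ≢ + 0
-k≢0 (s≤s _) ()

lookup-foldr-zipWith-+ : ∀ {A : Set} {k} (F : A → Vec ℤ k) xs i →
  lookup (foldr (λ x → zipWith ℤ._+_ (F x)) (replicate k (+ 0)) xs) i ≡ sumℤ (map (λ x → lookup (F x) i) xs)
lookup-foldr-zipWith-+ F []       i = Vec.lookup-replicate i (+ 0)
lookup-foldr-zipWith-+ F (x ∷ xs) i =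
  trans (Vec.lookup-zipWith ℤ._+_ i (F x) _) (cong (ℤ._+_ (lookup (F x) i)) (lookup-foldr-zipWith-+ F xs i))

negating-permutation⇒sum≡0 : ∀ {A : Set} {k} (F : A → Vec ℤ k) (π : A → A) xs → xs ↭ map π xs →
  (∀ {x} → x ∈ xs → F (π x) ≡ Vec.map -_ (F x)) →
  foldr (λ x → zipWith ℤ._+_ (F x)) (replicate k (+ 0)) xs ≡ replicate k (+ 0)
negating-permutation⇒sum≡0 F π xs xs↭πxs F∘π≡-F = Pointwise-≡⇒≡ (ext λ i →
  trans (lookup-foldr-zipWith-+ F xs i) (trans (i≡-i⇒i≡0 (sum≡-sum i)) (sym (Vec.lookup-replicate i (+ 0)))))
  where
    open ≡-Reasoning
    sum≡-sum : ∀ i → let f = λ x → lookup (F x) i in sumℤ (map f xs) ≡ - sumℤ (map f xs)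
    sum≡-sum i = let f = λ x → lookup (F x) i in begin
      sumℤ (map f xs)             ≡⟨ sumℤ-↭ (↭.map⁺ f xs↭πxs) ⟩
      sumℤ (map f (map π xs))     ≡⟨ cong sumℤ (map-∘ xs) ⟨
      sumℤ (map (f ∘ π) xs)       ≡⟨ cong sumℤ (map-cong-local (All.tabulate λ x∈xs →
                                       trans (cong (λ v → lookup v i) (F∘π≡-F x∈xs)) (Vec.lookup-map i -_ (F _)))) ⟩
      sumℤ (map (-_ ∘ f) xs)      ≡⟨ cong sumℤ (map-∘ xs) ⟩
      sumℤ (map -_ (map f xs))    ≡⟨ sumℤ-map-neg (map f xs) ⟩
      - sumℤ (map f xs)           ∎

module _ (m : ℕ) where

  -- h represents 1/2 ∈ C_{2^n}.
  private
    n h N : ℕ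
    n = suc m
    h = 2 ^ m
    N = 2 ^ n

    instance
      N≢0 : NonZero N
      N≢0 = m^n≢0 2 n

  open Modular N

  1≤h : 1 ≤ h
  1≤h = m^n>0 2 m

  h<N : h < N
  h<N = m<m+n h (subst (0 <_) (sym (+-identityʳ h)) 1≤h)

  0%N≡0 : 0 % N ≡ 0
  0%N≡0 = m<n⇒m%n≡m (m^n>0 2 n)

  odd*h≈h : ∀ {u} → Odd u → u * h ≈ h
  odd*h≈h {u} odd-u = begin
    u * h % N                    ≡⟨ cong (λ x → x * h % N) (odd⇒≡1+2* odd-u) ⟩
    (1 + 2 * (u / 2)) * h % N    ≡⟨ cong (_% N) (expand (u / 2) h) ⟩
    (h + u / 2 * N) % N          ≡⟨ [m+kn]%n≡m%n h (u / 2) N ⟩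
    h % N                        ∎
    where
      open ≡-Reasoning
      expand : ∀ t h → (1 + 2 * t) * h ≡ h + t * (2 * h)
      expand = solve-∀

  odd-inverse : ∀ {w} → Odd w → ∃ λ w⁻¹ → Odd w⁻¹ × w⁻¹ * w ≈ 1
  odd-inverse {w} odd-w with odd^2^k≡1+2^[k+1]* odd-w m
  ... | c , w^h≡1+Nc = w ^ (h ∸ 1) , odd-^ odd-w (h ∸ 1) , (begin
    w ^ (h ∸ 1) * w % N          ≡⟨ cong (_% N) (*-comm (w ^ (h ∸ 1)) w) ⟩
    w ^ suc (h ∸ 1) % N          ≡⟨ cong (λ e → w ^ e % N) (trans (+-comm 1 (h ∸ 1)) (m∸n+n≡m 1≤h)) ⟩
    w ^ h % N                    ≡⟨ cong (_% N) w^h≡1+Nc ⟩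
    (1 + N * c) % N              ≡⟨ cong (λ x → (1 + x) % N) (*-comm N c) ⟩
    (1 + c * N) % N              ≡⟨ [m+kn]%n≡m%n 1 c N ⟩
    1 % N                        ∎)
    where open ≡-Reasoning

  ∃odd-w*a≈a+h : ∀ {a} → a < N → a ≢ 0 → a ≢ h → ∃ λ w → Odd w × w * a ≈ a + h
  ∃odd-w*a≈a+h {a} a<N a≢0 a≢h with 2-adic-decomposition a a≢0
  ... | s , b , odd-b , a≡2^s*b with m ≤? s
  ...   | yes m≤s = ⊥-elim ([ a≢0 , a≢h ]′ (m∣n∧n<2m⇒n≡0⊎n≡m h∣a a<N))
    where
      h∣a : h ∣ a
      h∣a = divides (2 ^ (s ∸ m) * b) (begin
        a                            ≡⟨ a≡2^s*b ⟩
        2 ^ s * b                    ≡⟨ cong (λ e → 2 ^ e * b) (m+[n∸m]≡n m≤s) ⟨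
        2 ^ (m + (s ∸ m)) * b        ≡⟨ cong (_* b) (^-distribˡ-+-* 2 m (s ∸ m)) ⟩
        2 ^ m * 2 ^ (s ∸ m) * b      ≡⟨ rearrange (2 ^ m) (2 ^ (s ∸ m)) b ⟩
        2 ^ (s ∸ m) * b * 2 ^ m      ∎)
        where
          open ≡-Reasoning
          rearrange : ∀ x y z → x * y * z ≡ y * z * x
          rearrange = solve-∀
  ...   | no m≰s = 1 + 2 * 2 ^ d , odd-1+2* (2 ^ d) , (begin
      (1 + 2 * 2 ^ d) * a % N                      ≡⟨ cong (λ x → (1 + 2 * 2 ^ d) * x % N) a≡2^s*b ⟩
      (1 + 2 * 2 ^ d) * (2 ^ s * b) % N            ≡⟨ cong (_% N) (expand (2 ^ d) (2 ^ s) b) ⟩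
      (2 ^ s * b + b * (2 ^ s * (2 * 2 ^ d))) % N  ≡⟨ cong (λ x → (2 ^ s * b + b * x) % N) 2^s*2^[1+d]≡h ⟩
      (2 ^ s * b + b * h) % N                      ≡⟨ +-cong {2 ^ s * b} refl (odd*h≈h odd-b) ⟩
      (2 ^ s * b + h) % N                          ≡⟨ cong (λ x → (x + h) % N) a≡2^s*b ⟨
      (a + h) % N                                  ∎)
    where
      open ≡-Reasoning
      d = m ∸ suc s
      2^s*2^[1+d]≡h : 2 ^ s * (2 * 2 ^ d) ≡ h
      2^s*2^[1+d]≡h = trans (sym (^-distribˡ-+-* 2 s (suc d))) (cong (2 ^_) (trans (+-suc s d) (m+[n∸m]≡n (≰⇒> m≰s))))
      expand : ∀ D S b → (1 + 2 * D) * (S * b) ≡ S * b + b * (S * (2 * D))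
      expand = solve-∀

  2*b%N≡0⇔b≡0⊎b≡h : ∀ {b} → b < N → 2 * b % N ≡ 0 ⇔ (b ≡ 0 ⊎ b ≡ h)
  2*b%N≡0⇔b≡0⊎b≡h {b} b<N = mk⇔
    (λ 2b%N≡0 → m∣n∧n<2m⇒n≡0⊎n≡m (*-cancelˡ-∣ 2 (m%n≡0⇒n∣m (2 * b) N 2b%N≡0)) b<N)
    [ (λ { refl → 0%N≡0 }) , (λ { refl → n%n≡0 N }) ]′

  -- The group G_n and the multiplier action

  toℕ-red : ∀ a → toℕ (red n a) ≡ a % N
  toℕ-red a = Fin.toℕ-fromℕ< (m%n<n a N)

  toℕ-red-≈ : ∀ a → toℕ (red n a) ≈ a
  toℕ-red-≈ a = trans (cong (_% N) (toℕ-red a)) (%-≈ a)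

  toℕ<N : (c : C n) → toℕ c < N
  toℕ<N c = Fin.toℕ<n (val c)

  toℕ-injective : ∀ {c d : C n} → toℕ c ≡ toℕ d → c ≡ d
  toℕ-injective {⟨ _ ⟩} {⟨ _ ⟩} eq = cong ⟨_⟩ (Fin.toℕ-injective eq)

  red-cong : ∀ {a b} → a ≈ b → red n a ≡ red n b
  red-cong {a} {b} a≈b = toℕ-injective (trans (toℕ-red a) (trans a≈b (sym (toℕ-red b))))

  red-toℕ : (c : C n) → red n (toℕ c) ≡ c
  red-toℕ c = toℕ-injective (trans (toℕ-red (toℕ c)) (m<n⇒m%n≡m (toℕ<N c)))

  ⟦_,_⟧ : ℕ → ℕ → G n
  ⟦ a , b ⟧ = red n a , red n b

  ⟦⟧-cong : ∀ {a a′ b b′} → a ≈ a′ → b ≈ b′ → ⟦ a , b ⟧ ≡ ⟦ a′ , b′ ⟧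
  ⟦⟧-cong a≈a′ b≈b′ = cong₂ _,_ (red-cong a≈a′) (red-cong b≈b′)

  ⟦toℕ,toℕ⟧ : ∀ c d → ⟦ toℕ c , toℕ d ⟧ ≡ (c , d)
  ⟦toℕ,toℕ⟧ c d = cong₂ _,_ (red-toℕ c) (red-toℕ d)

  ·-⟦⟧ : ∀ u a b → u · ⟦ a , b ⟧ ≡ ⟦ u * a , u * b ⟧
  ·-⟦⟧ u a b = ⟦⟧-cong (*-congˡ u (toℕ-red-≈ a)) (*-congˡ u (toℕ-red-≈ b))

  ⟦⟧-⊕ : ∀ a b a′ b′ → ⟦ a , b ⟧ ⊕ ⟦ a′ , b′ ⟧ ≡ ⟦ a + a′ , b + b′ ⟧
  ⟦⟧-⊕ a b a′ b′ = ⟦⟧-cong (+-cong (toℕ-red-≈ a) (toℕ-red-≈ a′)) (+-cong (toℕ-red-≈ b) (toℕ-red-≈ b′))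

  ·-congʳ : ∀ {u v} → u ≈ v → (g : G n) → u · g ≡ v · g
  ·-congʳ u≈v (c , d) = ⟦⟧-cong (*-cong u≈v refl) (*-cong u≈v refl)

  ·-assoc : ∀ u v (g : G n) → u · (v · g) ≡ (u * v) · g
  ·-assoc u v (c , d) = trans (·-⟦⟧ u (v * toℕ c) (v * toℕ d))
    (cong₂ ⟦_,_⟧ (sym (*-assoc u v (toℕ c))) (sym (*-assoc u v (toℕ d))))

  ·-identityˡ : (g : G n) → 1 · g ≡ g
  ·-identityˡ (c , d) = trans (cong₂ ⟦_,_⟧ (+-identityʳ (toℕ c)) (+-identityʳ (toℕ d))) (⟦toℕ,toℕ⟧ c d)

  ·-suc : ∀ u (g : G n) → suc u · g ≡ g ⊕ (u · g)
  ·-suc u (c , d) = ⟦⟧-cong (+-cong {toℕ c} refl (sym (toℕ-red-≈ (u * toℕ c))))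
                            (+-cong {toℕ d} refl (sym (toℕ-red-≈ (u * toℕ d))))

  e₁ e₂ : G n
  e₁ = ⟦ 1 , 0 ⟧
  e₂ = ⟦ 0 , 1 ⟧

  ≡e₁-e₂-combination : ∀ c d → (c , d) ≡ (toℕ c · e₁) ⊕ (toℕ d · e₂)
  ≡e₁-e₂-combination c d = begin
    (c , d)                                      ≡⟨ ⟦toℕ,toℕ⟧ c d ⟨
    ⟦ a , b ⟧                                    ≡⟨ cong₂ ⟦_,_⟧ (coeff₁ a b) (coeff₂ a b) ⟩
    ⟦ a * 1 + b * 0 , a * 0 + b * 1 ⟧            ≡⟨ ⟦⟧-⊕ (a * 1) (a * 0) (b * 0) (b * 1) ⟨
    ⟦ a * 1 , a * 0 ⟧ ⊕ ⟦ b * 0 , b * 1 ⟧        ≡⟨ cong₂ _⊕_ (·-⟦⟧ a 1 0) (·-⟦⟧ b 0 1) ⟨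
    (a · e₁) ⊕ (b · e₂)                          ∎
    where
      open ≡-Reasoning
      a = toℕ c
      b = toℕ d
      coeff₁ : ∀ c d → c ≡ c * 1 + d * 0
      coeff₁ = solve-∀
      coeff₂ : ∀ c d → d ≡ c * 0 + d * 1
      coeff₂ = solve-∀

  -- Characters of G_n

  char-0G : ∀ {χ} → IsChar χ → toℕ (χ (0G n)) ≡ 0
  char-0G {χ} isChar = m<n∧[m+m]%n≡m⇒m≡0 (toℕ<N (χ (0G n))) (sym (begin
    z                         ≡⟨ cong (toℕ ∘ χ) (⟦⟧-⊕ 0 0 0 0) ⟨
    toℕ (χ (0G n ⊕ 0G n))     ≡⟨ cong toℕ (isChar (0G n) (0G n)) ⟩
    toℕ (red n (z + z))       ≡⟨ toℕ-red (z + z) ⟩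
    (z + z) % N               ∎))
    where
      open ≡-Reasoning
      z = toℕ (χ (0G n))

  char-· : ∀ {χ} → IsChar χ → ∀ u g → toℕ (χ (u · g)) ≡ u * toℕ (χ g) % N
  char-· {χ} isChar zero    (c , d) = trans (char-0G {χ} isChar) (sym 0%N≡0)
  char-· {χ} isChar (suc u) g = begin
    toℕ (χ (suc u · g))                           ≡⟨ cong (toℕ ∘ χ) (·-suc u g) ⟩
    toℕ (χ (g ⊕ (u · g)))                         ≡⟨ cong toℕ (isChar g (u · g)) ⟩
    toℕ (red n (toℕ (χ g) + toℕ (χ (u · g))))     ≡⟨ toℕ-red _ ⟩
    (toℕ (χ g) + toℕ (χ (u · g))) % N             ≡⟨ cong (λ x → (toℕ (χ g) + x) % N) (char-· {χ} isChar u g) ⟩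
    (toℕ (χ g) + u * toℕ (χ g) % N) % N           ≡⟨ +-cong {toℕ (χ g)} refl (%-≈ (u * toℕ (χ g))) ⟩
    (toℕ (χ g) + u * toℕ (χ g)) % N               ∎
    where open ≡-Reasoning

  Linear : (G n → C n) → ℕ → ℕ → Set
  Linear χ α β = ∀ c d → toℕ (χ (c , d)) ≡ (toℕ c * α + toℕ d * β) % N

  char-linear : ∀ {χ} → IsChar χ → Linear χ (toℕ (χ e₁)) (toℕ (χ e₂))
  char-linear {χ} isChar c d = begin
    toℕ (χ (c , d))                                          ≡⟨ cong (toℕ ∘ χ) (≡e₁-e₂-combination c d) ⟩
    toℕ (χ ((toℕ c · e₁) ⊕ (toℕ d · e₂)))                    ≡⟨ cong toℕ (isChar _ _) ⟩
    toℕ (red n (toℕ (χ (toℕ c · e₁)) + toℕ (χ (toℕ d · e₂)))) ≡⟨ toℕ-red _ ⟩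
    (toℕ (χ (toℕ c · e₁)) + toℕ (χ (toℕ d · e₂))) % N
      ≡⟨ cong₂ (λ x y → (x + y) % N) (char-· {χ} isChar (toℕ c) e₁) (char-· {χ} isChar (toℕ d) e₂) ⟩
    (toℕ c * α % N + toℕ d * β % N) % N                      ≡⟨ +-cong (%-≈ (toℕ c * α)) (%-≈ (toℕ d * β)) ⟩
    (toℕ c * α + toℕ d * β) % N                              ∎
    where
      open ≡-Reasoning
      α = toℕ (χ e₁)
      β = toℕ (χ e₂)

  linChar : ℕ → ℕ → G n → C n
  linChar α β (c , d) = red n (toℕ c * α + toℕ d * β)

  linChar-linear : ∀ α β → Linear (linChar α β) α β
  linChar-linear α β c d = toℕ-red (toℕ c * α + toℕ d * β)

  linChar-isChar : ∀ α β → IsChar (linChar α β)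
  linChar-isChar α β (c , d) (c′ , d′) = red-cong (begin
    (toℕ (red n (toℕ c + toℕ c′)) * α + toℕ (red n (toℕ d + toℕ d′)) * β) % N
      ≡⟨ +-cong (*-cong (toℕ-red-≈ (toℕ c + toℕ c′)) refl) (*-cong (toℕ-red-≈ (toℕ d + toℕ d′)) refl) ⟩
    ((toℕ c + toℕ c′) * α + (toℕ d + toℕ d′) * β) % N
      ≡⟨ cong (_% N) (distribute (toℕ c) (toℕ c′) (toℕ d) (toℕ d′) α β) ⟩
    ((toℕ c * α + toℕ d * β) + (toℕ c′ * α + toℕ d′ * β)) % N
      ≡⟨ +-cong (toℕ-red-≈ (toℕ c * α + toℕ d * β)) (toℕ-red-≈ (toℕ c′ * α + toℕ d′ * β)) ⟨
    (toℕ (linChar α β (c , d)) + toℕ (linChar α β (c′ , d′))) % N ∎)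
    where
      open ≡-Reasoning
      distribute : ∀ c c′ d d′ α β → (c + c′) * α + (d + d′) * β ≡ (c * α + d * β) + (c′ * α + d′ * β)
      distribute = solve-∀

  -- Square roots of higher order

  Annihilates : ℕ → ℕ → ℕ → Set
  Annihilates j α β = j * α % N ≡ 0 × j * β % N ≡ 0

  annihilates? : ∀ α β → Decidable (λ j → Annihilates j α β)
  annihilates? α β j = (j * α % N ≟ 0) ×-dec (j * β % N ≟ 0)

  linear-e₁ : ∀ χ {α β} → Linear χ α β → toℕ (χ e₁) ≈ α
  linear-e₁ χ {α} {β} lin = trans (cong (_% N) (lin (red n 1) (red n 0))) (trans (%-≈ _)
    (trans (+-cong (*-cong (toℕ-red-≈ 1) refl) (*-cong (toℕ-red-≈ 0) refl)) (cong (_% N) (coeff α β))))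
    where
      coeff : ∀ α β → 1 * α + 0 * β ≡ α
      coeff = solve-∀

  linear-e₂ : ∀ χ {α β} → Linear χ α β → toℕ (χ e₂) ≈ β
  linear-e₂ χ {α} {β} lin = trans (cong (_% N) (lin (red n 0) (red n 1))) (trans (%-≈ _)
    (trans (+-cong (*-cong (toℕ-red-≈ 0) refl) (*-cong (toℕ-red-≈ 1) refl)) (cong (_% N) (coeff α β))))
    where
      coeff : ∀ α β → 0 * α + 1 * β ≡ β
      coeff = solve-∀

  pow-trivial⇔annihilates : ∀ χ {α β} → Linear χ α β → ∀ j → IsTrivial (pow j χ) ⇔ Annihilates j α β
  pow-trivial⇔annihilates χ {α} {β} lin j = mk⇔
    (λ trivial → annihilates-value (trivial e₁) (linear-e₁ χ lin) , annihilates-value (trivial e₂) (linear-e₂ χ lin))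
    (λ (jα≡0 , jβ≡0) (c , d) → begin
      toℕ (red n (j * toℕ (χ (c , d))))               ≡⟨ toℕ-red _ ⟩
      j * toℕ (χ (c , d)) % N                         ≡⟨ cong (λ x → j * x % N) (lin c d) ⟩
      j * ((toℕ c * α + toℕ d * β) % N) % N           ≡⟨ *-congˡ j (%-≈ _) ⟩
      j * (toℕ c * α + toℕ d * β) % N                 ≡⟨ cong (_% N) (distribute j (toℕ c) (toℕ d) α β) ⟩
      (toℕ c * (j * α) + toℕ d * (j * β)) % N         ≡⟨ +-cong (*-congˡ (toℕ c) (trans jα≡0 (sym 0%N≡0)))
                                                                (*-congˡ (toℕ d) (trans jβ≡0 (sym 0%N≡0))) ⟩
      (toℕ c * 0 + toℕ d * 0) % N                     ≡⟨ cong (_% N) (cong₂ _+_ (*-zeroʳ (toℕ c)) (*-zeroʳ (toℕ d))) ⟩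
      0 % N                                           ≡⟨ 0%N≡0 ⟩
      0                                               ∎)
    where
      open ≡-Reasoning
      distribute : ∀ j c d α β → j * (c * α + d * β) ≡ c * (j * α) + d * (j * β)
      distribute = solve-∀
      annihilates-value : ∀ {g γ} → toℕ (red n (j * toℕ (χ g))) ≡ 0 → toℕ (χ g) ≈ γ → j * γ % N ≡ 0
      annihilates-value {g} {γ} triv χg≈γ = trans (*-congˡ j (sym χg≈γ)) (trans (sym (toℕ-red _)) triv)

  sq-linear : ∀ {χ ψ α β α₀ β₀} → Linear χ α β → Linear ψ α₀ β₀ → 2 * α₀ ≈ α → 2 * β₀ ≈ β →
    ∀ g → χ g ≡ sq ψ g
  sq-linear {χ} {ψ} {α} {β} {α₀} {β₀} linχ linψ 2α₀≈α 2β₀≈β (c , d) = toℕ-injective (begin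
    toℕ (χ (c , d))                          ≡⟨ linχ c d ⟩
    (toℕ c * α + toℕ d * β) % N              ≡⟨ +-cong (*-congˡ (toℕ c) 2α₀≈α) (*-congˡ (toℕ d) 2β₀≈β) ⟨
    (toℕ c * (2 * α₀) + toℕ d * (2 * β₀)) % N ≡⟨ cong (_% N) (factor (toℕ c) (toℕ d) α₀ β₀) ⟩
    2 * (toℕ c * α₀ + toℕ d * β₀) % N        ≡⟨ *-congˡ 2 (%-≈ _) ⟨
    2 * ((toℕ c * α₀ + toℕ d * β₀) % N) % N  ≡⟨ cong (λ x → 2 * x % N) (linψ c d) ⟨
    2 * toℕ (ψ (c , d)) % N                  ≡⟨ toℕ-red _ ⟨
    toℕ (sq ψ (c , d))                       ∎)
    where
      open ≡-Reasoning
      factor : ∀ c d α₀ β₀ → c * (2 * α₀) + d * (2 * β₀) ≡ 2 * (c * α₀ + d * β₀)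
      factor = solve-∀

  pow-sq-trivial : ∀ {χ ψ} → (∀ g → χ g ≡ sq ψ g) → ∀ j → IsTrivial (pow j ψ) → IsTrivial (pow j χ)
  pow-sq-trivial {χ} {ψ} χ≡ψ² j trivial g = begin
    toℕ (red n (j * toℕ (χ g)))              ≡⟨ toℕ-red _ ⟩
    j * toℕ (χ g) % N                        ≡⟨ cong (λ (x : C n) → j * toℕ x % N) (χ≡ψ² g) ⟩
    j * toℕ (red n (2 * toℕ (ψ g))) % N      ≡⟨ *-congˡ j (toℕ-red-≈ _) ⟩
    j * (2 * toℕ (ψ g)) % N                  ≡⟨ cong (_% N) (x∙yz≈y∙xz j 2 (toℕ (ψ g))) ⟩
    2 * (j * toℕ (ψ g)) % N                  ≡⟨ *-congˡ 2 (toℕ-red-≈ _) ⟨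
    2 * toℕ (red n (j * toℕ (ψ g))) % N      ≡⟨ cong (λ x → 2 * x % N) (trivial g) ⟩
    0 % N                                    ≡⟨ 0%N≡0 ⟩
    0                                        ∎
    where
      open ≡-Reasoning

  linear-order-exists : ∀ χ {α β} → Linear χ α β → ∃ (HasOrder χ)
  linear-order-exists χ {α} {β} lin =
    let (j , least) = least-positive (annihilates? α β) N (m^n>0 2 n) (N-annihilates α , N-annihilates β)
    in j , IsLeastPositive-resp-⇔ (λ j → ⇔-sym (pow-trivial⇔annihilates χ lin j)) least
    where
      N-annihilates : ∀ a → N * a % N ≡ 0
      N-annihilates a = trans (cong (_% N) (*-comm N a)) (m*n%n≡0 a N)

  odd-cancel-≡0 : ∀ {a} k → Odd a → k * a % N ≡ 0 → k % N ≡ 0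
  odd-cancel-≡0 {a} k odd-a ka≡0 with odd-inverse odd-a
  ... | a⁻¹ , _ , a⁻¹a≈1 = begin
    k % N                    ≡⟨ cong (_% N) (*-identityʳ k) ⟨
    k * 1 % N                ≡⟨ *-congˡ k a⁻¹a≈1 ⟨
    k * (a⁻¹ * a) % N        ≡⟨ cong (_% N) (x∙yz≈y∙xz k a⁻¹ a) ⟩
    a⁻¹ * (k * a) % N        ≡⟨ *-congˡ a⁻¹ (%-≈ (k * a)) ⟨
    a⁻¹ * (k * a % N) % N    ≡⟨ cong (λ x → a⁻¹ * x % N) ka≡0 ⟩
    a⁻¹ * 0 % N              ≡⟨ cong (_% N) (*-zeroʳ a⁻¹) ⟩
    0 % N                    ≡⟨ 0%N≡0 ⟩
    0                        ∎
    where
      open ≡-Reasoning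

  annihilated-by-proper⇒even : ∀ {k a} → 1 ≤ k → k < N → k * a % N ≡ 0 → ∃ λ t → a ≡ 2 * t
  annihilated-by-proper⇒even {k} {a} 1≤k k<N ka≡0 with even-or-odd a
  ... | inj₁ even-a = even-a
  ... | inj₂ odd-a  = ⊥-elim (<⇒≱ 1≤k (≤-reflexive (trans (sym (m<n⇒m%n≡m k<N)) (odd-cancel-≡0 k odd-a ka≡0))))

  ∃half-not-annihilated : ∀ {α β α₀ β₀ k} → IsLeastPositive (λ j → Annihilates j α β) k →
    α ≡ 2 * α₀ → β ≡ 2 * β₀ → ∃ λ α′ → 2 * α′ ≈ α × ¬ Annihilates k α′ β₀
  ∃half-not-annihilated {α} {β} {α₀} {β₀} {k} (1≤k , _ , least) α≡2α₀ β≡2β₀ with annihilates? α₀ β₀ k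
  ... | no ¬ann = α₀ , cong (_% N) (sym α≡2α₀) , ¬ann
  ... | yes (kα₀≡0 , kβ₀≡0) = α₀ + h , 2[α₀+h]≈α , shifted-not-annihilated
    where
      open ≡-Reasoning
      expand : ∀ a h → 2 * (a + h) ≡ 2 * a + 1 * (2 * h)
      expand = solve-∀
      2[α₀+h]≈α : 2 * (α₀ + h) ≈ α
      2[α₀+h]≈α = trans (cong (_% N) (expand α₀ h)) (trans ([m+kn]%n≡m%n (2 * α₀) 1 N) (cong (_% N) (sym α≡2α₀)))
      shifted-not-annihilated : ¬ Annihilates k (α₀ + h) β₀
      shifted-not-annihilated (k[α₀+h]≡0 , _) with even-or-odd k
      ... | inj₂ odd-k = <⇒≱ 1≤h (≤-reflexive (begin
        h                        ≡⟨ m<n⇒m%n≡m h<N ⟨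
        h % N                    ≡⟨ +-cong (trans kα₀≡0 (sym 0%N≡0)) (odd*h≈h odd-k) ⟨
        (k * α₀ + k * h) % N     ≡⟨ cong (_% N) (*-distribˡ-+ k α₀ h) ⟨
        k * (α₀ + h) % N         ≡⟨ k[α₀+h]≡0 ⟩
        0                        ∎))
      ... | inj₁ (t , k≡2t) = least t 1≤t t<k (halve α α₀ α≡2α₀ kα₀≡0 , halve β β₀ β≡2β₀ kβ₀≡0)
        where
          1≤t : 1 ≤ t
          1≤t = 1≤2m⇒1≤m t (subst (1 ≤_) k≡2t 1≤k)
          t<k : t < k
          t<k = subst (t <_) (sym k≡2t) (m<2m 1≤t)
          halve : ∀ γ γ₀ → γ ≡ 2 * γ₀ → k * γ₀ % N ≡ 0 → t * γ % N ≡ 0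
          halve γ γ₀ refl kγ₀≡0 = trans (cong (_% N) (trans (sym (*-assoc t 2 γ₀))
            (cong (_* γ₀) (trans (*-comm t 2) (sym k≡2t))))) kγ₀≡0

  square-root-of-higher-order : (χ : G n → C n) → IsChar χ → (k : ℕ) → HasOrder χ k → k < N →
    Σ (G n → C n) (λ ψ → IsChar ψ × (∀ g → χ g ≡ sq ψ g) × Σ ℕ (λ j → HasOrder ψ j × k < j))
  square-root-of-higher-order χ isChar k ord-k k<N =
    let linχ = char-linear {χ} isChar
        least-k = IsLeastPositive-resp-⇔ (pow-trivial⇔annihilates χ linχ) ord-k
        (1≤k , (kα≡0 , kβ≡0) , _) = least-k
        (α₀ , α≡2α₀) = annihilated-by-proper⇒even 1≤k k<N kα≡0
        (β₀ , β≡2β₀) = annihilated-by-proper⇒even 1≤k k<N kβ≡0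
        (α′ , 2α′≈α , ¬ann) = ∃half-not-annihilated {α₀ = α₀} {β₀ = β₀} least-k α≡2α₀ β≡2β₀
        linψ = linChar-linear α′ β₀
        χ≡ψ² = sq-linear linχ linψ 2α′≈α (cong (_% N) (sym β≡2β₀))
        (j , ord-j) = linear-order-exists (linChar α′ β₀) linψ
    in linChar α′ β₀ , linChar-isChar α′ β₀ , χ≡ψ² , j , ord-j ,
       IsLeastPositive-< (pow-sq-trivial χ≡ψ²) ord-k ord-j (¬ann ∘ Equivalence.to (pow-trivial⇔annihilates _ linψ k))

  -- Orbits

  InOrbit : G n → G n → Set
  InOrbit x g = ∃ λ u → Odd u × u · x ≡ g

  odd-%N : ∀ {u} → Odd u → Odd (u % N)
  odd-%N {u} (odd u%2≡1) = odd (trans (m∣n⇒o%n%m≡o%m 2 N u (divides h (*-comm 2 h))) u%2≡1)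

  T-eqGᵇ⇔≡ : ∀ (g g′ : G n) → T (eqGᵇ g g′) ⇔ g ≡ g′
  T-eqGᵇ⇔≡ (a , b) (c , d) = mk⇔
    (λ t → let (a≡c , b≡d) = Equivalence.to T-∧ t in
           cong₂ _,_ (toℕ-injective (≡ᵇ⇒≡ _ _ a≡c)) (toℕ-injective (≡ᵇ⇒≡ _ _ b≡d)))
    (λ { refl → Equivalence.from T-∧ (≡⇒≡ᵇ (toℕ a) (toℕ a) refl , ≡⇒≡ᵇ (toℕ b) (toℕ b) refl) })

  T-oddᵇ⇔Odd : ∀ u → T (oddᵇ u) ⇔ Odd u
  T-oddᵇ⇔Odd u = mk⇔ (λ t → odd (≡ᵇ⇒≡ (u % 2) 1 t)) (λ (odd u%2≡1) → ≡⇒≡ᵇ (u % 2) 1 u%2≡1)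

  inOrbitᵇ⇔InOrbit : ∀ (x g : G n) → inOrbitᵇ x g ≡ true ⇔ InOrbit x g
  inOrbitᵇ⇔InOrbit x g = mk⇔
    (λ inOrbit → let (u , _ , t) = find (any⁻ test (upTo (suc N)) (Equivalence.from T-≡ inOrbit))
                     (oddᵇ-u , eqGᵇ-ux-g) = Equivalence.to T-∧ t
                 in u , Equivalence.to (T-oddᵇ⇔Odd u) oddᵇ-u , Equivalence.to (T-eqGᵇ⇔≡ (u · x) g) eqGᵇ-ux-g)
    (λ (u , odd-u , ux≡g) → Equivalence.to T-≡ (any⁺ test (lose (∈-upTo⁺ (m≤n⇒m≤1+n (m%n<n u N)))
      (Equivalence.from T-∧ (Equivalence.from (T-oddᵇ⇔Odd (u % N)) (odd-%N odd-u) ,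
                             Equivalence.from (T-eqGᵇ⇔≡ _ g) (trans (·-congʳ (%-≈ u) x) ux≡g))))))
    where
      test : ℕ → Bool
      test u = oddᵇ u ∧ eqGᵇ (u · x) g

  ∈-allG : (g : G n) → g ∈ allG n
  ∈-allG (⟨ a ⟩ , ⟨ b ⟩) = ∈-cartesianProduct⁺ (∈-map⁺ ⟨_⟩ (∈-allFin a)) (∈-map⁺ ⟨_⟩ (∈-allFin b))

  ∈-Orbit⇔InOrbit : ∀ {x g : G n} → g ∈ Orbit x ⇔ InOrbit x g
  ∈-Orbit⇔InOrbit {x} {g} = mk⇔
    (λ g∈ → Equivalence.to (inOrbitᵇ⇔InOrbit x g)
              (Equivalence.to T-≡ (proj₂ (∈-filter⁻ (T? ∘ inOrbitᵇ x) {xs = allG n} g∈))))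
    (λ inOrbit → ∈-filter⁺ (T? ∘ inOrbitᵇ x) (∈-allG g)
                   (Equivalence.from T-≡ (Equivalence.from (inOrbitᵇ⇔InOrbit x g) inOrbit)))

  Orbit-unique : ∀ x → Unique (Orbit x)
  Orbit-unique x = Unique.filter⁺ (T? ∘ inOrbitᵇ x) (Unique.cartesianProduct⁺ allC-unique allC-unique)
    where
      allC-unique : Unique (map (⟨_⟩ {n}) (allFin N))
      allC-unique = Unique.map⁺ (cong val) (Unique.allFin⁺ N)

  x∈Orbit[x] : ∀ x → x ∈ Orbit x
  x∈Orbit[x] x = Equivalence.from ∈-Orbit⇔InOrbit (1 , odd refl , ·-identityˡ x)

  card-pos : ∀ x → 0 < card x
  card-pos x = ∈-length (x∈Orbit[x] x)

  Orbit-closed : ∀ {u x g} → Odd u → g ∈ Orbit x → u · g ∈ Orbit x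
  Orbit-closed {u} {x} odd-u g∈ with Equivalence.to ∈-Orbit⇔InOrbit g∈
  ... | v , odd-v , refl = Equivalence.from ∈-Orbit⇔InOrbit (u * v , odd-* odd-u odd-v , sym (·-assoc u v x))

  odd-·-inverse : ∀ {w} → Odd w →
    ∃ λ w⁻¹ → Odd w⁻¹ × (∀ g → w⁻¹ · (w · g) ≡ g) × (∀ g → w · (w⁻¹ · g) ≡ g)
  odd-·-inverse {w} odd-w with odd-inverse odd-w
  ... | w⁻¹ , odd-w⁻¹ , w⁻¹w≈1 =
    w⁻¹ , odd-w⁻¹ , cancel w⁻¹ w w⁻¹w≈1 , cancel w w⁻¹ (trans (cong (_% N) (*-comm w w⁻¹)) w⁻¹w≈1)
    where
      cancel : ∀ a b → a * b ≈ 1 → ∀ g → a · (b · g) ≡ g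
      cancel a b ab≈1 g = trans (·-assoc a b g) (trans (·-congʳ ab≈1 g) (·-identityˡ g))

  Orbit-↭ : ∀ {w} x → Odd w → Orbit x ↭ map (_·_ {n} w) (Orbit x)
  Orbit-↭ {w} x odd-w = ∼bag⇒↭ (unique∧set⇒bag (Orbit-unique x) (Unique.map⁺ w·-injective (Orbit-unique x))
      (mk⇔ (λ g∈ → subst (_∈ map (_·_ {n} w) (Orbit x)) (w·w⁻¹· _) (∈-map⁺ (_·_ {n} w) (Orbit-closed odd-w⁻¹ g∈)))
           (λ g∈ → let (g′ , g′∈ , g≡wg′) = ∈-map⁻ (_·_ {n} w) g∈
                   in subst (_∈ Orbit x) (sym g≡wg′) (Orbit-closed odd-w g′∈))))
    where
      w⁻¹ = proj₁ (odd-·-inverse odd-w)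
      odd-w⁻¹ = proj₁ (proj₂ (odd-·-inverse odd-w))
      w⁻¹·w· = proj₁ (proj₂ (proj₂ (odd-·-inverse odd-w)))
      w·w⁻¹· = proj₂ (proj₂ (proj₂ (odd-·-inverse odd-w)))
      w·-injective : ∀ {g g′} → w · g ≡ w · g′ → g ≡ g′
      w·-injective {g} {g′} wg≡wg′ = trans (sym (w⁻¹·w· g)) (trans (cong (_·_ {n} w⁻¹) wg≡wg′) (w⁻¹·w· g′))

  -- Character sums over orbits

  basis-neg : ∀ c j → basis n (- c) j ≡ Vec.map -_ (basis n c j)
  basis-neg c j = trans (Vec.tabulate-cong (λ i → if-neg (Data.Fin.toℕ i ≡ᵇ j))) (Vec.tabulate-∘ -_ _)
    where
      if-neg : ∀ b → (if b then - c else + 0) ≡ - (if b then c else + 0)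
      if-neg true  = refl
      if-neg false = refl

  zeta-< : ∀ {a} → a < h → zeta n a ≡ basis n (+ 1) a
  zeta-< {a} a<h with a <ᵇ h | <⇒<ᵇ a<h
  ... | true | _ = refl

  zeta-h+ : ∀ {d} → d < h → zeta n (h + d) ≡ basis n (- + 1) d
  zeta-h+ {d} d<h with h + d <ᵇ h in h+d<ᵇh
  ... | true  = ⊥-elim (<⇒≱ (<ᵇ⇒< (h + d) h (Equivalence.from T-≡ h+d<ᵇh)) (m≤m+n h d))
  ... | false = cong (basis n (- + 1)) (m+n∸m≡n h d)

  zeta-0 : zeta n 0 ≡ int n (+ 1)
  zeta-0 = zeta-< 1≤h

  zeta-h : zeta n h ≡ int n (- + 1)
  zeta-h = trans (cong (zeta n) (sym (+-identityʳ h))) (zeta-h+ 1≤h)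

  zeta-+h : ∀ {a} → a < N → zeta n ((a + h) % N) ≡ Vec.map -_ (zeta n a)
  zeta-+h {a} a<N with <2m⇒<m⊎≡m+ a<N
  ... | inj₁ a<h = begin
    zeta n ((a + h) % N)           ≡⟨ cong (zeta n) (trans (m<n⇒m%n≡m a+h<N) (+-comm a h)) ⟩
    zeta n (h + a)                 ≡⟨ zeta-h+ a<h ⟩
    basis n (- + 1) a              ≡⟨ basis-neg (+ 1) a ⟩
    Vec.map -_ (basis n (+ 1) a)   ≡⟨ cong (Vec.map -_) (zeta-< a<h) ⟨
    Vec.map -_ (zeta n a)          ∎
    where
      open ≡-Reasoning
      a+h<N : a + h < N
      a+h<N = subst (a + h <_) (cong (_+_ h) (sym (+-identityʳ h))) (+-monoˡ-< h a<h)
  ... | inj₂ (d , d<h , refl) = begin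
    zeta n ((h + d + h) % N)            ≡⟨ cong (zeta n) [h+d+h]%N≡d ⟩
    zeta n d                            ≡⟨ zeta-< d<h ⟩
    basis n (+ 1) d                     ≡⟨ basis-neg (- + 1) d ⟩
    Vec.map -_ (basis n (- + 1) d)      ≡⟨ cong (Vec.map -_) (zeta-h+ d<h) ⟨
    Vec.map -_ (zeta n (h + d))         ∎
    where
      open ≡-Reasoning
      rearrange : ∀ h d → h + d + h ≡ d + 1 * (2 * h)
      rearrange = solve-∀
      [h+d+h]%N≡d : (h + d + h) % N ≡ d
      [h+d+h]%N≡d = trans (cong (_% N) (rearrange h d))
        (trans ([m+kn]%n≡m%n d 1 N) (m<n⇒m%n≡m (<-trans d<h h<N)))

  lookup-int-* : ∀ k c i → lookup (int n (k ℤ.* c)) i ≡ k ℤ.* lookup (int n c) i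
  lookup-int-* k c i = trans (Vec.lookup∘tabulate _ i)
    (trans (scale-if (Data.Fin.toℕ i ≡ᵇ 0)) (cong (ℤ._*_ k) (sym (Vec.lookup∘tabulate _ i))))
    where
      scale-if : ∀ b → (if b then k ℤ.* c else + 0) ≡ k ℤ.* (if b then c else + 0)
      scale-if true  = refl
      scale-if false = sym (ℤ.*-zeroʳ k)

  i₀ : Data.Fin.Fin (half n)
  i₀ = Data.Fin.fromℕ< 1≤h

  lookup-int-i₀ : ∀ c → lookup (int n c) i₀ ≡ c
  lookup-int-i₀ c = trans (Vec.lookup∘tabulate _ i₀) (cong (λ k → if k ≡ᵇ 0 then c else + 0) (Fin.toℕ-fromℕ< 1≤h))

  int-injective : ∀ {c c′} → int n c ≡ int n c′ → c ≡ c′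
  int-injective {c} {c′} eq = trans (sym (lookup-int-i₀ c)) (trans (cong (λ v → lookup v i₀) eq) (lookup-int-i₀ c′))

  int≡0c⇒≡0 : ∀ {c} → int n c ≡ 0c n → c ≡ + 0
  int≡0c⇒≡0 {c} eq = trans (sym (lookup-int-i₀ c)) (trans (cong (λ v → lookup v i₀) eq) (Vec.lookup-replicate i₀ (+ 0)))

  char-on-Orbit : ∀ {χ x g} → IsChar χ → g ∈ Orbit x → ∃ λ u → Odd u × toℕ (χ g) ≡ u * toℕ (χ x) % N
  char-on-Orbit {χ} {x} isChar g∈ with Equivalence.to ∈-Orbit⇔InOrbit g∈
  ... | u , odd-u , refl = u , odd-u , char-· {χ} isChar u x

  charSum-const : ∀ {χ : G n → C n} {x c} → (∀ {g} → g ∈ Orbit x → zeta n (toℕ (χ g)) ≡ int n c) →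
    charSum χ x ≡ int n (+ card x ℤ.* c)
  charSum-const {χ} {x} {c} ζ[χg]≡c = Pointwise-≡⇒≡ (ext λ i → begin
    lookup (charSum χ x) i
      ≡⟨ lookup-foldr-zipWith-+ (λ g → zeta n (toℕ (χ g))) (Orbit x) i ⟩
    sumℤ (map (λ g → lookup (zeta n (toℕ (χ g))) i) (Orbit x))
      ≡⟨ cong sumℤ (map-cong-local (All.tabulate λ g∈ → cong (λ v → lookup v i) (ζ[χg]≡c g∈))) ⟩
    sumℤ (map (const (lookup (int n c) i)) (Orbit x))             ≡⟨ sumℤ-map-const _ (Orbit x) ⟩
    + card x ℤ.* lookup (int n c) i                               ≡⟨ lookup-int-* (+ card x) c i ⟨
    lookup (int n (+ card x ℤ.* c)) i                             ∎)
    where open ≡-Reasoning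

  charSum≡card : ∀ {χ x} → IsChar χ → toℕ (χ x) ≡ 0 → charSum χ x ≡ int n (+ card x)
  charSum≡card {χ} {x} isChar χx≡0 = trans (charSum-const {χ} {x} ζ[χg]≡1) (cong (int n) (ℤ.*-identityʳ (+ card x)))
    where
      ζ[χg]≡1 : ∀ {g} → g ∈ Orbit x → zeta n (toℕ (χ g)) ≡ int n (+ 1)
      ζ[χg]≡1 g∈ with char-on-Orbit {χ} isChar g∈
      ... | u , _ , χg≡ = trans (cong (zeta n) (trans χg≡ (trans (cong (λ a → u * a % N) χx≡0)
                            (trans (cong (_% N) (*-zeroʳ u)) 0%N≡0)))) zeta-0

  charSum≡-card : ∀ {χ x} → IsChar χ → toℕ (χ x) ≡ h → charSum χ x ≡ int n (- + card x)
  charSum≡-card {χ} {x} isChar χx≡h = trans (charSum-const {χ} {x} ζ[χg]≡-1)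
      (cong (int n) (trans (sym (ℤ.neg-distribʳ-* (+ card x) (+ 1))) (cong -_ (ℤ.*-identityʳ (+ card x)))))
    where
      ζ[χg]≡-1 : ∀ {g} → g ∈ Orbit x → zeta n (toℕ (χ g)) ≡ int n (- + 1)
      ζ[χg]≡-1 g∈ with char-on-Orbit {χ} isChar g∈
      ... | u , odd-u , χg≡ = trans (cong (zeta n) (trans χg≡ (trans (cong (λ a → u * a % N) χx≡h)
                                (trans (odd*h≈h odd-u) (m<n⇒m%n≡m h<N))))) zeta-h

  charSum≡0c : ∀ {χ x} → IsChar χ → toℕ (χ x) ≢ 0 → toℕ (χ x) ≢ h → charSum χ x ≡ 0c n
  charSum≡0c {χ} {x} isChar χx≢0 χx≢h with ∃odd-w*a≈a+h (toℕ<N (χ x)) χx≢0 χx≢h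
  ... | w , odd-w , wa≈a+h = negating-permutation⇒sum≡0 (λ g → zeta n (toℕ (χ g))) (_·_ {n} w) (Orbit x)
      (Orbit-↭ x odd-w) (λ {g} g∈ → trans (cong (zeta n) (χ[wg]≡χg+h g∈)) (zeta-+h (toℕ<N (χ g))))
    where
      open ≡-Reasoning
      a = toℕ (χ x)
      χ[wg]≡χg+h : ∀ {g} → g ∈ Orbit x → toℕ (χ (w · g)) ≡ (toℕ (χ g) + h) % N
      χ[wg]≡χg+h {g} g∈ with char-on-Orbit {χ} isChar g∈
      ... | u , odd-u , χg≡ = begin
        toℕ (χ (w · g))               ≡⟨ char-· {χ} isChar w g ⟩
        w * toℕ (χ g) % N             ≡⟨ cong (λ c → w * c % N) χg≡ ⟩
        w * (u * a % N) % N           ≡⟨ *-congˡ w (%-≈ (u * a)) ⟩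
        w * (u * a) % N               ≡⟨ cong (_% N) (x∙yz≈y∙xz w u a) ⟩
        u * (w * a) % N               ≡⟨ *-congˡ u wa≈a+h ⟩
        u * (a + h) % N               ≡⟨ cong (_% N) (*-distribˡ-+ u a h) ⟩
        (u * a + u * h) % N           ≡⟨ +-cong (sym (%-≈ (u * a))) (odd*h≈h odd-u) ⟩
        (u * a % N + h) % N           ≡⟨ cong (λ c → (c + h) % N) χg≡ ⟨
        (toℕ (χ g) + h) % N           ∎

  charSum-cases : ∀ {χ} → IsChar χ → ∀ x →
    (toℕ (χ x) ≡ 0 × charSum χ x ≡ int n (+ card x)) ⊎
    (toℕ (χ x) ≡ h × charSum χ x ≡ int n (- + card x)) ⊎
    charSum χ x ≡ 0c n
  charSum-cases {χ} isChar x with toℕ (χ x) ≟ 0 | toℕ (χ x) ≟ h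
  ... | yes χx≡0 | _        = inj₁ (χx≡0 , charSum≡card {χ} isChar χx≡0)
  ... | no  _    | yes χx≡h = inj₂ (inj₁ (χx≡h , charSum≡-card {χ} isChar χx≡h))
  ... | no  χx≢0 | no  χx≢h = inj₂ (inj₂ (charSum≡0c {χ} isChar χx≢0 χx≢h))

  charSum≡card⇔ : ∀ {χ} → IsChar χ → ∀ x → charSum χ x ≡ int n (+ card x) ⇔ toℕ (χ x) ≡ 0
  charSum≡card⇔ {χ} isChar x = mk⇔ value (charSum≡card {χ} isChar)
    where
      value : charSum χ x ≡ int n (+ card x) → toℕ (χ x) ≡ 0
      value S≡card with charSum-cases {χ} isChar x
      ... | inj₁ (χx≡0 , _)           = χx≡0
      ... | inj₂ (inj₁ (_ , S≡-card)) = ⊥-elim (+k≢0 (card-pos x) (i≡-i⇒i≡0 (int-injective (trans (sym S≡card) S≡-card))))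
      ... | inj₂ (inj₂ S≡0)           = ⊥-elim (+k≢0 (card-pos x) (int≡0c⇒≡0 (trans (sym S≡card) S≡0)))

  charSum≡-card⇔ : ∀ {χ} → IsChar χ → ∀ x → charSum χ x ≡ int n (- + card x) ⇔ toℕ (χ x) ≡ h
  charSum≡-card⇔ {χ} isChar x = mk⇔ value (charSum≡-card {χ} isChar)
    where
      value : charSum χ x ≡ int n (- + card x) → toℕ (χ x) ≡ h
      value S≡-card with charSum-cases {χ} isChar x
      ... | inj₁ (_ , S≡card)         = ⊥-elim (+k≢0 (card-pos x) (i≡-i⇒i≡0 (int-injective (trans (sym S≡card) S≡-card))))
      ... | inj₂ (inj₁ (χx≡h , _))    = χx≡h
      ... | inj₂ (inj₂ S≡0)           = ⊥-elim (-k≢0 (card-pos x) (int≡0c⇒≡0 (trans (sym S≡-card) S≡0)))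

  -- Squares of characters

  sq-value : ∀ {χ ψ : G n → C n} → (∀ g → χ g ≡ sq ψ g) → ∀ g → toℕ (χ g) ≡ 2 * toℕ (ψ g) % N
  sq-value χ≡ψ² g = trans (cong toℕ (χ≡ψ² g)) (toℕ-red _)

  sq-kernel⇔ : ∀ {χ ψ} → IsChar ψ → (∀ g → χ g ≡ sq ψ g) → ∀ x →
    toℕ (χ x) ≡ 0 ⇔ (charSum ψ x ≡ int n (+ card x) ⊎ charSum ψ x ≡ int n (- + card x))
  sq-kernel⇔ {χ} {ψ} isψ χ≡ψ² x = ⇔-trans (mk⇔ (trans (sym χx≡)) (trans χx≡))
    (⇔-trans (2*b%N≡0⇔b≡0⊎b≡h (toℕ<N (ψ x)))
             (⇔-sym (charSum≡card⇔ {ψ} isψ x ⊎-⇔ charSum≡-card⇔ {ψ} isψ x)))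
    where
      χx≡ : toℕ (χ x) ≡ 2 * toℕ (ψ x) % N
      χx≡ = sq-value {χ} {ψ} χ≡ψ² x

  sq-half⇔child : ∀ {χ ψ} → IsChar χ → IsChar ψ → (∀ g → χ g ≡ sq ψ g) → ∀ x →
    toℕ (χ x) ≡ h ⇔ Σ (G n) (λ y → ChildOf x y × charSum ψ y ≡ int n (- + card y))
  sq-half⇔child {χ} {ψ} isχ isψ χ≡ψ² x = mk⇔
    (λ χx≡h → 2 · x ,
              (x≢0G χx≡h , Equivalence.from (inOrbitᵇ⇔InOrbit (2 · x) (2 · x)) (1 , odd refl , ·-identityˡ (2 · x))) ,
              Equivalence.from (charSum≡-card⇔ {ψ} isψ (2 · x)) (trans ψ[2x]≡χx χx≡h))
    (λ (y , (_ , 2x∈[y]) , S≡-card) → case Equivalence.to (inOrbitᵇ⇔InOrbit y (2 · x)) 2x∈[y] of λ where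
      (u , odd-u , uy≡2x) → begin
        toℕ (χ x)              ≡⟨ ψ[2x]≡χx ⟨
        toℕ (ψ (2 · x))        ≡⟨ cong (toℕ ∘ ψ) uy≡2x ⟨
        toℕ (ψ (u · y))        ≡⟨ char-· {ψ} isψ u y ⟩
        u * toℕ (ψ y) % N      ≡⟨ cong (λ c → u * c % N) (Equivalence.to (charSum≡-card⇔ {ψ} isψ y) S≡-card) ⟩
        u * h % N              ≡⟨ odd*h≈h odd-u ⟩
        h % N                  ≡⟨ m<n⇒m%n≡m h<N ⟩
        h                      ∎)
    where
      open ≡-Reasoning
      ψ[2x]≡χx : toℕ (ψ (2 · x)) ≡ toℕ (χ x)
      ψ[2x]≡χx = trans (char-· {ψ} isψ 2 x) (sym (sq-value {χ} {ψ} χ≡ψ² x))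
      x≢0G : toℕ (χ x) ≡ h → x ≢ 0G n
      x≢0G χx≡h refl = <⇒≱ 1≤h (≤-reflexive (trans (sym χx≡h) (char-0G {χ} isχ)))

theorem2p5 : (n : ℕ) → 2 ≤ n →
  ((χ : G n → C n) → IsChar χ → (k : ℕ) → HasOrder χ k → k < 2 ^ n →
    Σ (G n → C n) (λ ψ → IsChar ψ × (∀ g → χ g ≡ sq ψ g) ×
      Σ ℕ (λ j → HasOrder ψ j × k < j)))
  ×
  ((χ ψ : G n → C n) → IsChar χ → IsChar ψ → (∀ g → χ g ≡ sq ψ g) →
    (x : G n) →
      ((charSum χ x ≡ int n (+ card x)) ⇔
        ((charSum ψ x ≡ int n (+ card x)) ⊎ (charSum ψ x ≡ int n (- (+ card x)))))
      ×
      ((charSum χ x ≡ int n (- (+ card x))) ⇔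
        Σ (G n) (λ y → ChildOf x y × (charSum ψ y ≡ int n (- (+ card y)))))
      ×
      (¬ ((charSum ψ x ≡ int n (+ card x)) ⊎ (charSum ψ x ≡ int n (- (+ card x)))) →
        ¬ Σ (G n) (λ y → ChildOf x y × (charSum ψ y ≡ int n (- (+ card y)))) →
        charSum χ x ≡ 0c n))
theorem2p5 zero ()
theorem2p5 (suc m) _ = square-root-of-higher-order m , λ χ ψ isχ isψ χ≡ψ² x →
  let kernel = ⇔-trans (charSum≡card⇔ m {χ} isχ x) (sq-kernel⇔ m {χ} isψ χ≡ψ² x)
      half   = ⇔-trans (charSum≡-card⇔ m {χ} isχ x) (sq-half⇔child m isχ isψ χ≡ψ² x)
  in kernel , half , λ ¬kernel ¬half → charSum≡0c m {χ} isχ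
       (¬kernel ∘ Equivalence.to kernel ∘ charSum≡card m {χ} isχ)
       (¬half ∘ Equivalence.to half ∘ charSum≡-card m {χ} isχ)
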